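{- Let $A$ be a model, $\phi$ a $2n$-ary formula, and let $\mathcal C,\mathcal E\subseteq A^n$ be $\phi$-chains that are mutually cofinal. Then $\mathrm{cf}(\mathcal C,\preceq_\phi)=\mathrm{cf}(\mathcal E,\preceq_\phi)$.
   Context: $\vec a\prec_\phi\vec b$ iff $A\models\phi(\vec a,\vec b)\wedge\neg\phi(\vec b,\vec a)$; $\vec a\preceq_\phi\vec b$ iff $\vec a\prec_\phi\vec b$ or $\vec a=\vec b$ (this relation need not be transitive on $A^n$). A $\phi$-chain is a subset of $A^n$ linearly ordered by $\preceq_\phi$, and $\mathrm{cf}$ denotes its cofinality. $\mathcal C$ and $\mathcal E$ are mutually cofinal if for every $\vec a\in\mathcal C$ there is $\vec b_0\in\mathcal E$ with $\vec a\prec_\phi\vec b$ for all $\vec b\in\mathcal E$ with $\vec b_0\preceq_\phi\vec b$, and for every $\vec b\in\mathcal E$ there is $\vec a_0\in\mathcal C$ with $\vec b\prec_\phi\vec a$ for all $\vec a\in\mathcal C$ with $\vec a_0\preceq_\phi\vec a$. -}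

module Defs where

open import Data.Nat using (ℕ)
open import Data.Vec using (Vec)
open import Data.Product using (Σ; ∃; _×_; _,_)
open import Data.Sum using (_⊎_)
open import Relation.Nullary using (¬_)
open import Relation.Binary.PropositionalEquality using (_≡_)
open import Function.Bundles using (_⇔_)

-- A : the universe of the model; n : arity; φ : the 2n-ary formula,
-- represented by its interpretation φ(a⃗, b⃗) in A, a relation on A^n.
module _ {A : Set} {n : ℕ} (φ : Vec A n → Vec A n → Set) where

  _≺_ : Vec A n → Vec A n → Set
  a ≺ b = φ a b × ¬ φ b a

  _⪯_ : Vec A n → Vec A n → Set
  a ⪯ b = (a ≺ b) ⊎ (a ≡ b)

  -- A φ-chain: a subset C ⊆ A^n linearly ordered by ⪯φ
  -- (reflexivity holds by definition of ⪯φ).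
  record IsChain (C : Vec A n → Set) : Set where
    field
      antisym : ∀ {a b} → C a → C b → a ⪯ b → b ⪯ a → a ≡ b
      trans   : ∀ {a b c} → C a → C b → C c → a ⪯ b → b ⪯ c → a ⪯ c
      total   : ∀ {a b} → C a → C b → (a ⪯ b) ⊎ (b ⪯ a)

  MutuallyCofinal : (C E : Vec A n → Set) → Set
  MutuallyCofinal C E =
    (∀ a → C a → Σ (Vec A n) λ b₀ → E b₀ × (∀ b → E b → b₀ ⪯ b → a ≺ b))
    × (∀ b → E b → Σ (Vec A n) λ a₀ → C a₀ × (∀ a → C a → a₀ ⪯ a → b ≺ a))

  -- cf(C, ⪯φ) ≤ |I| : there is a cofinal subset of C indexed by I,
  -- i.e. a family f : I → C whose image is cofinal in (C, ⪯φ).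
  CfAtMost : (C : Vec A n → Set) → (I : Set) → Set
  CfAtMost C I =
    Σ (I → Vec A n) λ f → (∀ i → C (f i)) × (∀ c → C c → ∃ λ i → c ⪯ f i)

  -- cf(C, ⪯φ) = cf(E, ⪯φ): for every index type (cardinal) I,
  -- cf(C) ≤ |I|  iff  cf(E) ≤ |I|.
  SameCofinality : (C E : Vec A n → Set) → Set₁
  SameCofinality C E = (I : Set) → CfAtMost C I ⇔ CfAtMost E I

-- A cofinal family in C is pushed into E by sending each of its members a to the start b₀
-- of a tail of E lying strictly above a. Every e ∈ E lies strictly below some tail of C,
-- hence strictly below some member f i of the family, hence below the start of the tail
-- of E chosen for f i: otherwise that start would lie below e, putting e strictly above
-- f i as well, against the asymmetry of ≺φ.
module Submission where

open import Defs
open import Data.Nat using (ℕ)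
open import Data.Vec using (Vec)
open import Data.Product using (Σ; _×_; _,_; proj₁; proj₂)
open import Data.Sum using (inj₁; inj₂)
open import Data.Empty using (⊥-elim)
open import Function.Bundles using (mk⇔)
open import Relation.Nullary using (¬_)

module _ {A : Set} {n : ℕ} (φ : Vec A n → Vec A n → Set) where

  private
    _≺φ_ _⪯φ_ : Vec A n → Vec A n → Set
    _≺φ_ = _≺_ φ
    _⪯φ_ = _⪯_ φ

  StrictlyBelowTail : (E : Vec A n → Set) → Vec A n → Vec A n → Set
  StrictlyBelowTail E a b₀ = ∀ b → E b → b₀ ⪯φ b → a ≺φ b

  -- One half of MutuallyCofinal φ C E, which unfolds to Dominated C E × Dominated E C.
  Dominated : (C E : Vec A n → Set) → Set
  Dominated C E = ∀ a → C a → Σ (Vec A n) λ b₀ → E b₀ × StrictlyBelowTail E a b₀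

  ≺-asym : ∀ {a b} → a ≺φ b → ¬ b ≺φ a
  ≺-asym (φab , _) (_ , ¬φab) = ¬φab φab

  ≺-below-tail⇒⪯-start : ∀ {E a b₀ e} → IsChain φ E → E e → E b₀ →
                          StrictlyBelowTail E a b₀ → e ≺φ a → e ⪯φ b₀
  ≺-below-tail⇒⪯-start chE e∈E b₀∈E a<tail e≺a
    with IsChain.total chE e∈E b₀∈E
  ... | inj₁ e⪯b₀ = e⪯b₀
  ... | inj₂ b₀⪯e = ⊥-elim (≺-asym e≺a (a<tail _ e∈E b₀⪯e))

  cfAtMost-transfer : ∀ {C E} → IsChain φ E → Dominated C E → Dominated E C →
                      (I : Set) → CfAtMost φ C I → CfAtMost φ E I
  cfAtMost-transfer {C} {E} chE C≤E E≤C I (f , f∈C , f-cofinal) = g , g∈E , g-cofinal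
    where
    g : I → Vec A n
    g i = proj₁ (C≤E (f i) (f∈C i))

    g∈E : ∀ i → E (g i)
    g∈E i = proj₁ (proj₂ (C≤E (f i) (f∈C i)))

    f<tail-g : ∀ i → StrictlyBelowTail E (f i) (g i)
    f<tail-g i = proj₂ (proj₂ (C≤E (f i) (f∈C i)))

    g-cofinal : ∀ e → E e → Σ I λ i → e ⪯φ g i
    g-cofinal e e∈E with E≤C e e∈E
    ... | a₀ , a₀∈C , e<tail with f-cofinal a₀ a₀∈C
    ...   | i , a₀⪯fi =
            i , ≺-below-tail⇒⪯-start chE e∈E (g∈E i) (f<tail-g i) (e<tail (f i) (f∈C i) a₀⪯fi)

lemma3p5 : {A : Set} {n : ℕ} (φ : Vec A n → Vec A n → Set)
    (C E : Vec A n → Set) →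
    IsChain φ C → IsChain φ E → MutuallyCofinal φ C E →
    SameCofinality φ C E
lemma3p5 φ C E chC chE (C≤E , E≤C) I =
  mk⇔ (cfAtMost-transfer φ chE C≤E E≤C I) (cfAtMost-transfer φ chC E≤C C≤E I)
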